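{- Let $\mathcal{F}$ be a non-trivial minor-closed class of multigraphs and let $d_{\mathcal{F}}>0$ be such that every multigraph $H\in\mathcal{F}$ satisfies $|E(H)|\leq \mu(H)\cdot d_{\mathcal{F}}\cdot|V(H)|$. Let $m$ be a positive integer and $G$ a multigraph with $\mu(G)\leq m$ and $\delta(G)\geq 3m\cdot d_{\mathcal{F}}$. Then for every $X\subseteq V(G)$ with $G-X\in\mathcal{F}$, \[|E(G)|\;\leq\;2\sum_{v\in X}\mathsf{edeg}_G(v)\;\leq\;4|E(G)|.\]
   Context: Graphs are finite multigraphs without loops; edges are counted with multiplicity. $\mu(G)$ is the maximum multiplicity of an edge of $G$. $\mathsf{edeg}_G(v)$ is the number of edges of $G$ incident to $v$, and $\delta(G)$ is the minimum of $\mathsf{edeg}_G(v)$ over $v\in V(G)$.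
   Formalization: The constant $d_{\mathcal{F}}$ is taken to be a positive rational. -}

module Defs where

open import Data.Nat using (ℕ; zero; suc; _+_; _*_; _⊔_; _≤_; _<ᵇ_)
open import Data.Bool using (Bool; true; false; if_then_else_; _∧_)
open import Data.Fin using (Fin; zero; suc; toℕ; inject₁; fromℕ; _≟_)
open import Data.Fin.Subset using (Subset)
open import Data.Vec using (lookup)
open import Data.Product using (Σ; _×_; ∃; ∃-syntax)
open import Data.Empty using (⊥)
open import Function.Definitions using (Injective)
open import Function.Bundles using (_⤖_; Bijection)
open import Relation.Nullary using (¬_)
open import Relation.Nullary.Decidable using (⌊_⌋)
open import Relation.Binary.PropositionalEquality using (_≡_; _≢_)

-- Finite loopless multigraph on vertex set Fin n, given by its
-- edge-multiplicity function w (w i j = number of edges between i and j).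
record Multigraph : Set where
  field
    n        : ℕ
    w        : Fin n → Fin n → ℕ
    sym      : ∀ i j → w i j ≡ w j i
    loopless : ∀ i → w i i ≡ 0
open Multigraph public

sumFin : (k : ℕ) → (Fin k → ℕ) → ℕ
sumFin zero    f = 0
sumFin (suc k) f = f zero + sumFin k (λ i → f (suc i))

maxFin : (k : ℕ) → (Fin k → ℕ) → ℕ
maxFin zero    f = 0
maxFin (suc k) f = f zero ⊔ maxFin k (λ i → f (suc i))

numEdges : Multigraph → ℕ
numEdges G = sumFin (n G) λ i → sumFin (n G) λ j →
  if toℕ j <ᵇ toℕ i then w G i j else 0

edeg : (G : Multigraph) → Fin (n G) → ℕ
edeg G v = sumFin (n G) λ j → w G v j

mu : Multigraph → ℕ
mu G = maxFin (n G) λ i → maxFin (n G) λ j → w G i j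

sumDegOver : (G : Multigraph) → Subset (n G) → ℕ
sumDegOver G X = sumFin (n G) λ v → if lookup X v then edeg G v else 0

Isomorphic : Multigraph → Multigraph → Set
Isomorphic H G = Σ (Fin (n H) ⤖ Fin (n G)) λ σ →
  ∀ i j → w H i j ≡ w G (Bijection.to σ i) (Bijection.to σ j)

EdgeSubgraph : Multigraph → Multigraph → Set
EdgeSubgraph H G = Σ (n H ≡ n G) λ { _≡_.refl → ∀ i j → w H i j ≤ w G i j }

DeleteLast : Multigraph → Multigraph → Set
DeleteLast H G = Σ (n G ≡ suc (n H)) λ { _≡_.refl →
  ∀ i j → w H i j ≡ w G (inject₁ i) (inject₁ j) }

-- merge : Fin (2+k) → Fin (1+k) identifies the last two vertices
merge : (k : ℕ) → Fin (suc (suc k)) → Fin (suc k)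
merge zero    _       = zero
merge (suc k) zero    = zero
merge (suc k) (suc i) = suc (merge k i)

-- H is obtained from G by contracting an edge between the last two
-- vertices of G (edges between the two endpoints disappear, all other
-- parallel edges are kept, so multiplicities add up)
ContractLast : Multigraph → Multigraph → Set
ContractLast H G = Σ ℕ λ k → Σ (n G ≡ suc (suc k)) λ { _≡_.refl →
  Σ (n H ≡ suc k) λ { _≡_.refl →
    (1 ≤ w G (inject₁ (fromℕ k)) (fromℕ (suc k))) ×
    (∀ x y → x ≢ y → w H x y ≡
       sumFin (suc (suc k)) λ i → sumFin (suc (suc k)) λ j →
         if ⌊ merge k i ≟ x ⌋ ∧ ⌊ merge k j ≟ y ⌋ then w G i j else 0) } }

MinorClosed : (Multigraph → Set) → Set
MinorClosed F =
  (∀ G H → F G → Isomorphic H G → F H) ×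
  (∀ G H → F G → EdgeSubgraph H G → F H) ×
  (∀ G H → F G → DeleteLast H G → F H) ×
  (∀ G H → F G → ContractLast H G → F H)

NonTrivial : (Multigraph → Set) → Set
NonTrivial F = ∃[ G ] ¬ F G

-- G - X is in F: some (hence, by isomorphism-closure, every) labelled copy
-- of the subgraph of G induced on V(G) \ X belongs to F.
-- A labelled copy is given by an injective enumeration e : Fin k → V(G)
-- whose image is exactly the complement of X.
DeleteSetIn : (Multigraph → Set) → (G : Multigraph) → Subset (n G) → Set
DeleteSetIn F G X =
  Σ ℕ λ k → Σ (Fin k → Fin (n G)) λ e →
    Injective _≡_ _≡_ e ×
    (∀ v → (lookup X v ≡ false) → ∃[ i ] e i ≡ v) ×
    (∀ i → lookup X (e i) ≡ false) ×
    Σ (Multigraph) λ H → Σ (n H ≡ k) λ { _≡_.refl →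
      (∀ i j → w H i j ≡ w G (e i) (e j)) × F H }

-- Let Y be the complement of X and e(·,·) count edges. Double counting gives
-- 2|E(G)| = 2e(X) + 2e(X,Y) + 2e(Y), Σ_{v∈X} edeg v = 2e(X) + e(X,Y) and
-- Σ_{v∈Y} edeg v = e(X,Y) + 2e(Y). Since G - X lies in F and μ(G - X) ≤ m, the
-- density bound and the minimum degree give 3e(Y) ≤ 3m·d·|Y| ≤ Σ_{v∈Y} edeg v,
-- i.e. e(Y) ≤ e(X,Y); both inequalities follow.
module Submission where

open import Defs hiding (sym)
open import Data.Nat using (ℕ; zero; suc; _+_; _*_; _≤_; _<ᵇ_; z≤n)
open import Data.Nat.Properties
open import Data.Nat.Solver using (module +-*-Solver)
open +-*-Solver using (solve; _:+_; _:*_; _:=_; con)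
open import Data.Bool using (Bool; true; false; not; _∧_; if_then_else_)
open import Data.Fin using (Fin; zero; suc; toℕ; punchIn)
open import Data.Fin.Properties using (toℕ-injective; punchInᵢ≢i) renaming (_≟_ to _≟ᶠ_)
open import Data.Fin.Subset using (Subset)
open import Data.Vec using (lookup)
open import Data.Product using (_×_; _,_; ∃)
open import Function.Base using (_∘_)
open import Function.Definitions using (Injective)
open import Relation.Nullary using (does; contradiction)
open import Relation.Nullary.Decidable using (dec-true; dec-false)
open import Relation.Nullary.Reflects using (ofʸ; ofⁿ)
open import Relation.Binary.PropositionalEquality
  using (_≡_; _≢_; refl; sym; trans; cong; cong₂; subst; module ≡-Reasoning)
open import Algebra.Properties.Semiring.Sum +-*-semiring
  using (sum; sum-syntax; sum-cong-≗; sum-replicate-zero; sum-remove;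
         ∑-distrib-+; ∑-comm; *-distribʳ-sum)

sumFin≡∑ : ∀ k (f : Fin k → ℕ) → sumFin k f ≡ ∑[ i < k ] f i
sumFin≡∑ zero    f = refl
sumFin≡∑ (suc k) f = cong (f zero +_) (sumFin≡∑ k (f ∘ suc))

∑-zero : ∀ {k} {f : Fin k → ℕ} → (∀ i → f i ≡ 0) → ∑[ i < k ] f i ≡ 0
∑-zero {k} f≡0 = trans (sum-cong-≗ f≡0) (sum-replicate-zero k)

∑-single : ∀ {k} (f : Fin k → ℕ) i₀ → (∀ i → i ≢ i₀ → f i ≡ 0) → ∑[ i < k ] f i ≡ f i₀
∑-single {suc k} f i₀ f≡0 = begin
  sum f                           ≡⟨ sum-remove f ⟩
  f i₀ + ∑[ j < k ] f (punchIn i₀ j) ≡⟨ cong (f i₀ +_) (∑-zero (λ j → f≡0 _ (punchInᵢ≢i i₀ j))) ⟩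
  f i₀ + 0                        ≡⟨ +-identityʳ _ ⟩
  f i₀                            ∎
  where open ≡-Reasoning

∑-mono : ∀ {k} {f g : Fin k → ℕ} → (∀ i → f i ≤ g i) → ∑[ i < k ] f i ≤ ∑[ i < k ] g i
∑-mono {zero}  f≤g = z≤n
∑-mono {suc k} f≤g = +-mono-≤ (f≤g zero) (∑-mono (f≤g ∘ suc))

∑-const : ∀ k c → ∑[ i < k ] c ≡ k * c
∑-const zero    c = refl
∑-const (suc k) c = cong (c +_) (∑-const k c)

infixr 20 [_]·_

[_]·_ : Bool → ℕ → ℕ
[ b ]· x = if b then x else 0

[]·-split : ∀ b x → x ≡ [ b ]· x + [ not b ]· x
[]·-split true  x = sym (+-identityʳ x)
[]·-split false x = refl

[]·-distrib-+ : ∀ b x y → [ b ]· (x + y) ≡ [ b ]· x + [ b ]· y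
[]·-distrib-+ true  x y = refl
[]·-distrib-+ false x y = refl

[]·-comm : ∀ a b x → [ a ]· [ b ]· x ≡ [ b ]· [ a ]· x
[]·-comm true  b     x = refl
[]·-comm false true  x = refl
[]·-comm false false x = refl

[]·-∑ : ∀ {k} b (f : Fin k → ℕ) → [ b ]· (∑[ i < k ] f i) ≡ ∑[ i < k ] [ b ]· f i
[]·-∑ true  f = refl
[]·-∑ {k} false f = sym (∑-zero {k} (λ _ → refl))

∑-split : ∀ {k} (S : Fin k → Bool) (f : Fin k → ℕ) →
  ∑[ i < k ] f i ≡ ∑[ i < k ] [ S i ]· f i + ∑[ i < k ] [ not (S i) ]· f i
∑-split S f = trans (sum-cong-≗ (λ i → []·-split (S i) (f i)))
                    (∑-distrib-+ (λ i → [ S i ]· f i) (λ i → [ not (S i) ]· f i))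

EnumeratesComplement : ∀ {k N} → (Fin N → Bool) → (Fin k → Fin N) → Set
EnumeratesComplement Y e =
  Injective _≡_ _≡_ e × (∀ v → Y v ≡ false → ∃ λ i → e i ≡ v) × (∀ i → Y (e i) ≡ false)

∑-reindex : ∀ {k N} {Y : Fin N → Bool} {e : Fin k → Fin N} → EnumeratesComplement Y e →
  (f : Fin N → ℕ) → ∑[ i < k ] f (e i) ≡ ∑[ v < N ] [ not (Y v) ]· f v
-- Both sides are the double sum of [e i = v]·f v, taken by rows and by columns.
∑-reindex {k} {N} {Y} {e} (inj , onto , outside) f = begin
  ∑[ i < k ] f (e i)                 ≡⟨ sum-cong-≗ row ⟨
  ∑[ i < k ] ∑[ v < N ] δ i v        ≡⟨ ∑-comm δ ⟩
  ∑[ v < N ] ∑[ i < k ] δ i v        ≡⟨ sum-cong-≗ column ⟩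
  ∑[ v < N ] [ not (Y v) ]· f v      ∎
  where
  open ≡-Reasoning
  δ : Fin k → Fin N → ℕ
  δ i v = [ does (e i ≟ᶠ v) ]· f v
  δ-on : ∀ i {v} → e i ≡ v → δ i v ≡ f v
  δ-on i eᵢ≡v = cong ([_]· _) (dec-true (e i ≟ᶠ _) eᵢ≡v)
  δ-off : ∀ i v → v ≢ e i → δ i v ≡ 0
  δ-off i v v≢eᵢ rewrite dec-false (e i ≟ᶠ v) (v≢eᵢ ∘ sym) = refl
  row : ∀ i → ∑[ v < N ] δ i v ≡ f (e i)
  row i = trans (∑-single (δ i) (e i) (δ-off i)) (δ-on i refl)
  column : ∀ v → ∑[ i < k ] δ i v ≡ [ not (Y v) ]· f v
  column v with Y v in Yv
  ... | true  = ∑-zero λ i → δ-off i v λ v≡eᵢ →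
    contradiction (trans (sym Yv) (trans (cong Y v≡eᵢ) (outside i))) λ ()
  ... | false with onto v Yv
  ... | i₀ , eᵢ₀≡v = trans (∑-single (λ i → δ i v) i₀ λ i i≢i₀ → δ-off i v λ v≡eᵢ →
                                  i≢i₀ (inj (trans (sym v≡eᵢ) (sym eᵢ₀≡v))))
                           (δ-on i₀ eᵢ₀≡v)

module _ (G : Multigraph) where

  -- Ordered pairs are counted: edgesBetween S S is twice the number of edges inside S.
  edgesBetween : (S T : Fin (n G) → Bool) → ℕ
  edgesBetween S T = ∑[ v < n G ] [ S v ]· (∑[ u < n G ] [ T u ]· w G v u)

  degreeSum : (S : Fin (n G) → Bool) → ℕ
  degreeSum S = ∑[ v < n G ] [ S v ]· edeg G v

  edeg≡∑ : ∀ v → edeg G v ≡ ∑[ u < n G ] w G v u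
  edeg≡∑ v = sumFin≡∑ (n G) (w G v)

  edgesBetween-comm : ∀ S T → edgesBetween S T ≡ edgesBetween T S
  edgesBetween-comm S T = begin
    ∑[ v < N ] [ S v ]· (∑[ u < N ] [ T u ]· w G v u)  ≡⟨ sum-cong-≗ (λ v → []·-∑ (S v) (λ u → [ T u ]· w G v u)) ⟩
    ∑[ v < N ] ∑[ u < N ] [ S v ]· [ T u ]· w G v u    ≡⟨ ∑-comm (λ v u → [ S v ]· [ T u ]· w G v u) ⟩
    ∑[ u < N ] ∑[ v < N ] [ S v ]· [ T u ]· w G v u    ≡⟨ sum-cong-≗ (λ u → sum-cong-≗ (λ v → swapped u v)) ⟩
    ∑[ u < N ] ∑[ v < N ] [ T u ]· [ S v ]· w G u v    ≡⟨ sum-cong-≗ (λ u → sym ([]·-∑ (T u) (λ v → [ S v ]· w G u v))) ⟩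
    ∑[ u < N ] [ T u ]· (∑[ v < N ] [ S v ]· w G u v)  ∎
    where
    open ≡-Reasoning
    N = n G
    swapped : ∀ u v → [ S v ]· [ T u ]· w G v u ≡ [ T u ]· [ S v ]· w G u v
    swapped u v = trans ([]·-comm (S v) (T u) _) (cong ([ T u ]·_ ∘ [ S v ]·_) (Multigraph.sym G v u))

  degreeSum≡edgesBetween+edgesBetween : ∀ S T →
    degreeSum S ≡ edgesBetween S T + edgesBetween S (not ∘ T)
  degreeSum≡edgesBetween+edgesBetween S T =
    trans (sum-cong-≗ split-at) (∑-distrib-+ (λ v → [ S v ]· (∑[ u < n G ] [ T u ]· w G v u)) _)
    where
    split-at : ∀ v → [ S v ]· edeg G v ≡
      [ S v ]· (∑[ u < n G ] [ T u ]· w G v u) + [ S v ]· (∑[ u < n G ] [ not (T u) ]· w G v u)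
    split-at v = trans (cong ([ S v ]·_) (trans (edeg≡∑ v) (∑-split T (w G v)))) ([]·-distrib-+ (S v) _ _)

  w≡[>]·w+[<]·w : ∀ v u → w G v u ≡ [ toℕ u <ᵇ toℕ v ]· w G v u + [ toℕ v <ᵇ toℕ u ]· w G u v
  w≡[>]·w+[<]·w v u
    with toℕ u <ᵇ toℕ v | <ᵇ-reflects-< (toℕ u) (toℕ v)
       | toℕ v <ᵇ toℕ u | <ᵇ-reflects-< (toℕ v) (toℕ u)
  ... | true  | ofʸ u<v | true  | ofʸ v<u = contradiction u<v (<-asym v<u)
  ... | true  | _       | false | _       = sym (+-identityʳ _)
  ... | false | _       | true  | _       = Multigraph.sym G v u
  ... | false | ofⁿ u≮v | false | ofⁿ v≮u =
    subst (λ x → w G v x ≡ 0) (toℕ-injective (≤∧≮⇒≡ (≮⇒≥ u≮v) v≮u)) (loopless G v)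

  handshake : ∑[ v < n G ] edeg G v ≡ 2 * numEdges G
  handshake = begin
    ∑[ v < N ] edeg G v                                  ≡⟨ sum-cong-≗ (λ v → trans (edeg≡∑ v) (sum-cong-≗ (w≡[>]·w+[<]·w v))) ⟩
    ∑[ v < N ] ∑[ u < N ] (below v u + below u v)        ≡⟨ sum-cong-≗ (λ v → ∑-distrib-+ (below v) (λ u → below u v)) ⟩
    ∑[ v < N ] (∑[ u < N ] below v u + ∑[ u < N ] below u v) ≡⟨ ∑-distrib-+ (λ v → ∑[ u < N ] below v u) _ ⟩
    E + ∑[ v < N ] ∑[ u < N ] below u v                  ≡⟨ cong (E +_) (∑-comm (λ v u → below u v)) ⟩
    E + E                                                ≡⟨ cong (E +_) (sym (+-identityʳ E)) ⟩
    2 * E                                                ≡⟨ cong (2 *_) numEdges≡E ⟨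
    2 * numEdges G                                       ∎
    where
    open ≡-Reasoning
    N = n G
    below : Fin N → Fin N → ℕ
    below v u = [ toℕ u <ᵇ toℕ v ]· w G v u
    E = ∑[ v < N ] ∑[ u < N ] below v u
    numEdges≡E : numEdges G ≡ E
    numEdges≡E = trans (sumFin≡∑ N _) (sum-cong-≗ (λ v → sumFin≡∑ N (below v)))

maxFin-upper : ∀ k (f : Fin k → ℕ) i → f i ≤ maxFin k f
maxFin-upper (suc k) f zero    = m≤m⊔n _ _
maxFin-upper (suc k) f (suc i) = ≤-trans (maxFin-upper k (f ∘ suc) i) (m≤n⊔m _ _)

maxFin-lub : ∀ k (f : Fin k → ℕ) {c} → (∀ i → f i ≤ c) → maxFin k f ≤ c
maxFin-lub zero    f f≤c = z≤n
maxFin-lub (suc k) f f≤c = ⊔-lub (f≤c zero) (maxFin-lub k (f ∘ suc) (f≤c ∘ suc))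

w≤mu : ∀ G i j → w G i j ≤ mu G
w≤mu G i j = ≤-trans (maxFin-upper (n G) (w G i) j) (maxFin-upper (n G) (λ i → maxFin (n G) (w G i)) i)

module _ (G H : Multigraph) {e : Fin (n H) → Fin (n G)}
         (w≡ : ∀ i j → w H i j ≡ w G (e i) (e j)) where

  mu-embedded≤mu : mu H ≤ mu G
  mu-embedded≤mu = maxFin-lub (n H) _ λ i → maxFin-lub (n H) _ λ j →
    subst (_≤ mu G) (sym (w≡ i j)) (w≤mu G (e i) (e j))

  2*numEdges-induced≡edgesBetween : ∀ {Y} → EnumeratesComplement Y e →
    2 * numEdges H ≡ edgesBetween G (not ∘ Y) (not ∘ Y)
  2*numEdges-induced≡edgesBetween {Y} enum = begin
    2 * numEdges H                                       ≡⟨ handshake H ⟨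
    ∑[ i < k ] edeg H i                                  ≡⟨ sum-cong-≗ (λ i → trans (edeg≡∑ H i) (sum-cong-≗ (w≡ i))) ⟩
    ∑[ i < k ] ∑[ j < k ] w G (e i) (e j)                ≡⟨ sum-cong-≗ (λ i → ∑-reindex enum (w G (e i))) ⟩
    ∑[ i < k ] ∑[ u < N ] [ not (Y u) ]· w G (e i) u     ≡⟨ ∑-reindex enum (λ v → ∑[ u < N ] [ not (Y u) ]· w G v u) ⟩
    edgesBetween G (not ∘ Y) (not ∘ Y)                   ∎
    where
    open ≡-Reasoning
    k = n H
    N = n G

3*E≤∑d : ∀ {k E μ m p q} (d : Fin k → ℕ) → E * suc q ≤ μ * p * k → μ ≤ m →
  (∀ i → 3 * m * p ≤ d i * suc q) → 3 * E ≤ ∑[ i < k ] d i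
3*E≤∑d {k} {E} {μ} {m} {p} {q} d sparse μ≤m d-large = *-cancelʳ-≤ _ _ (suc q) (begin
  3 * E * suc q                    ≡⟨ *-assoc 3 E (suc q) ⟩
  3 * (E * suc q)                  ≤⟨ *-monoʳ-≤ 3 sparse ⟩
  3 * (μ * p * k)                  ≤⟨ *-monoʳ-≤ 3 (*-monoˡ-≤ k (*-monoˡ-≤ p μ≤m)) ⟩
  3 * (m * p * k)                  ≡⟨ solve 3 (λ m p k → con 3 :* (m :* p :* k) := k :* (con 3 :* m :* p)) refl m p k ⟩
  k * (3 * m * p)                  ≡⟨ ∑-const k (3 * m * p) ⟨
  ∑[ i < k ] (3 * m * p)           ≤⟨ ∑-mono d-large ⟩
  ∑[ i < k ] (d i * suc q)         ≡⟨ *-distribʳ-sum (suc q) d ⟨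
  (∑[ i < k ] d i) * suc q         ∎)
  where open ≤-Reasoning

t≤2s≤4t : ∀ {a b h t} → 2 * t ≡ (a + b) + (b + 2 * h) → h ≤ b →
  t ≤ 2 * (a + b) × 2 * (a + b) ≤ 4 * t
t≤2s≤4t {a} {b} {h} {t} 2t≡ h≤b = *-cancelˡ-≤ 2 upper , lower
  where
  open ≤-Reasoning
  upper : 2 * t ≤ 2 * (2 * (a + b))
  upper = begin
    2 * t                        ≡⟨ 2t≡ ⟩
    (a + b) + (b + 2 * h)        ≤⟨ +-monoʳ-≤ (a + b) (+-monoʳ-≤ b (*-monoʳ-≤ 2 h≤b)) ⟩
    (a + b) + (b + 2 * b)        ≤⟨ m≤m+n _ (3 * a) ⟩
    (a + b) + (b + 2 * b) + 3 * a ≡⟨ solve 2 (λ a b → (a :+ b) :+ (b :+ con 2 :* b) :+ con 3 :* a := con 2 :* (con 2 :* (a :+ b))) refl a b ⟩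
    2 * (2 * (a + b))            ∎
  lower : 2 * (a + b) ≤ 4 * t
  lower = begin
    2 * (a + b)                  ≤⟨ m≤m+n _ (2 * (b + 2 * h)) ⟩
    2 * (a + b) + 2 * (b + 2 * h) ≡⟨ *-distribˡ-+ 2 (a + b) _ ⟨
    2 * ((a + b) + (b + 2 * h))  ≡⟨ cong (2 *_) 2t≡ ⟨
    2 * (2 * t)                  ≡⟨ *-assoc 2 2 t ⟨
    4 * t                        ∎

lemmaA1 : (F : Multigraph → Set) → MinorClosed F → NonTrivial F →
    (p q : ℕ) → 1 ≤ p → 1 ≤ q →
    (∀ H → F H → numEdges H * q ≤ mu H * p * n H) →
    (m : ℕ) → 1 ≤ m →
    (G : Multigraph) → mu G ≤ m →
    (∀ v → 3 * m * p ≤ edeg G v * q) →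
    (X : Subset (n G)) → DeleteSetIn F G X →
    (numEdges G ≤ 2 * sumDegOver G X) × (2 * sumDegOver G X ≤ 4 * numEdges G)
lemmaA1 F _ _ p (suc q) _ _ sparse m _ G μ≤m δ≥ X (k , e , inj , onto , outside , H , refl , w≡ , H∈F) =
  subst (λ s → numEdges G ≤ 2 * s × 2 * s ≤ 4 * numEdges G) (sym s≡a+b) (t≤2s≤4t {a} 2E≡ h≤b)
  where
  Y = lookup X
  Ȳ = not ∘ Y
  enum : EnumeratesComplement Y e
  enum = inj , onto , outside
  a = edgesBetween G Y Y
  b = edgesBetween G Y Ȳ
  h = numEdges H
  s≡a+b : sumDegOver G X ≡ a + b
  s≡a+b = trans (sumFin≡∑ (n G) (λ v → [ Y v ]· edeg G v)) (degreeSum≡edgesBetween+edgesBetween G Y Y)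
  degreeSumȲ : degreeSum G Ȳ ≡ b + 2 * h
  degreeSumȲ = trans (degreeSum≡edgesBetween+edgesBetween G Ȳ Y)
    (cong₂ _+_ (edgesBetween-comm G Ȳ Y) (sym (2*numEdges-induced≡edgesBetween G H w≡ enum)))
  2E≡ : 2 * numEdges G ≡ (a + b) + (b + 2 * h)
  2E≡ = trans (sym (handshake G)) (trans (∑-split Y (edeg G))
    (cong₂ _+_ (degreeSum≡edgesBetween+edgesBetween G Y Y) degreeSumȲ))
  3h≤b+2h : 3 * h ≤ b + 2 * h
  3h≤b+2h = subst (3 * h ≤_) (trans (∑-reindex enum (edeg G)) degreeSumȲ)
    (3*E≤∑d {E = h} (edeg G ∘ e) (sparse H H∈F) (≤-trans (mu-embedded≤mu G H w≡) μ≤m) (δ≥ ∘ e))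
  h≤b : h ≤ b
  -- 3 * h reduces to h + 2 * h
  h≤b = +-cancelʳ-≤ (2 * h) h b 3h≤b+2h
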